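{- Let $D=(V,A)$ be a finite digraph with underlying undirected graph $G=(V,E)$, let $\emptyset\neq B\subseteq E$, and let $P\subseteq\mathbb R^{2|B|}$ be the polyhedron defined below. If $x=(\overrightarrow{x},\overleftarrow{x})$ is a point of $P$, then there exists a point $y=(\overrightarrow{y},\overleftarrow{y})\in P$ with $\operatorname{supp}(y)\subseteq\operatorname{supp}(x)$ such that for every edge $a\in B$: $\overrightarrow{y}_a=\overleftarrow{y}_a=\tfrac12$ if $a$ is a bridge of the graph $(V,B)$, and $\min\{\overrightarrow{y}_a,\overleftarrow{y}_a\}=0$ otherwise.
   Context: Digraphs may have loops, parallel and antiparallel arcs. $G$ is obtained from $D$ by forgetting orientations and identifying antiparallel arcs, so each edge $e$ of $G$ between $u$ and $v$ corresponds to the arcs $u\to v$ and/or $v\to u$ present in $A$. Fix for each $e\in B$ a reference orientation, and let $M$ be the (totally unimodular) vertex–edge incidence matrix of $(V,B)$ with respect to it. Coordinates: for $e\in B$, $\overrightarrow{x}_e$ is the value on $e$ in its reference orientation and $\overleftarrow{x}_e$ the value on the reverse orientation. $P$ is the set of $(\overrightarrow{x},\overleftarrow{x})\in\mathbb R^{2|B|}$ with $(M,-M)\binom{\overrightarrow{x}}{\overleftarrow{x}}=0$, $\overrightarrow{x}_e+\overleftarrow{x}_e\ge1$ for all $e\in B$, a coordinate equal to $0$ whenever the corresponding oriented arc is not in $A$, and $\overrightarrow{x},\overleftarrow{x}\ge0$. $\operatorname{supp}(y)$ is the set of coordinates where $y$ is nonzero.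
   Formalization: The points $x$ and $y$ of $P$ are taken in ℚ^(2|B|) rather than $\mathbb R^{2|B|}$. -}

module Defs where

open import Data.Nat using (ℕ; zero; suc)
open import Data.Fin using (Fin; zero; suc)
open import Data.Bool using (Bool; true; false; T; _∨_)
open import Data.Rational using (ℚ; 0ℚ; 1ℚ; _+_; _-_; -_; _≤_; _⊓_; ½)
open import Data.Product using (_×_)
open import Relation.Binary.PropositionalEquality using (_≡_; _≢_)
open import Relation.Nullary using (¬_; Dec; yes; no)
open import Data.Fin using (_≟_)

Σℚ : ∀ {k} → (Fin k → ℚ) → ℚ
Σℚ {zero}  f = 0ℚ
Σℚ {suc k} f = f zero + Σℚ (λ i → f (suc i))

-- The data (D, G, B): vertices Fin n, the edges of B are Fin k.
-- Edge e has reference orientation tl e → hd e; fwd e / bwd e say whether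
-- the arc tl e → hd e, resp. hd e → tl e, is an arc of D.  Since e is an
-- edge of G, at least one of them is present.
record Setup (n k : ℕ) : Set where
  field
    tl hd   : Fin k → Fin n
    fwd bwd : Fin k → Bool
    covered : ∀ e → T (fwd e ∨ bwd e)
open Setup public

-- Entry M_{v,e} of the vertex–edge incidence matrix of (V,B) w.r.t. the
-- reference orientation (+1 at head, -1 at tail, column 0 for loops).
inc : ∀ {n k} → Setup n k → Fin n → Fin k → ℚ
inc S v e with v ≟ hd S e | v ≟ tl S e
... | yes _ | yes _ = 0ℚ
... | yes _ | no  _ = 1ℚ
... | no  _ | yes _ = - 1ℚ
... | no  _ | no  _ = 0ℚ

rowv : ∀ {n k} → Setup n k → (Fin k → ℚ) → (Fin k → ℚ) → Fin n → ℚ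
rowv S xf xb v = Σℚ (λ e → inc S v e Data.Rational.* xf e)
               - Σℚ (λ e → inc S v e Data.Rational.* xb e)

InP : ∀ {n k} → Setup n k → (Fin k → ℚ) → (Fin k → ℚ) → Set
InP S xf xb =
    (∀ v → rowv S xf xb v ≡ 0ℚ)
  × (∀ e → 1ℚ ≤ xf e + xb e)
  × (∀ e → fwd S e ≡ false → xf e ≡ 0ℚ)
  × (∀ e → bwd S e ≡ false → xb e ≡ 0ℚ)
  × (∀ e → 0ℚ ≤ xf e)
  × (∀ e → 0ℚ ≤ xb e)

SuppSub : ∀ {k} → (Fin k → ℚ) → (Fin k → ℚ) → (Fin k → ℚ) → (Fin k → ℚ) → Set
SuppSub yf yb xf xb = (∀ e → xf e ≡ 0ℚ → yf e ≡ 0ℚ) × (∀ e → xb e ≡ 0ℚ → yb e ≡ 0ℚ)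

data ReachWithout {n k} (S : Setup n k) (a : Fin k) : Fin n → Fin n → Set where
  here  : ∀ {u} → ReachWithout S a u u
  stepF : ∀ {w} (e : Fin k) → e ≢ a → ReachWithout S a (hd S e) w → ReachWithout S a (tl S e) w
  stepB : ∀ {w} (e : Fin k) → e ≢ a → ReachWithout S a (tl S e) w → ReachWithout S a (hd S e) w

Bridge : ∀ {n k} → Setup n k → Fin k → Set
Bridge S a = ¬ ReachWithout S a (tl S a) (hd S a)

{-# OPTIONS --safe #-}
module Submission where

-- Write z = yf - yb for the net flow of a point y of P along the reference orientations; the
-- equations (M, -M) y = 0 say that z is a circulation, so its net flow into any vertex set C is 0.
-- Fix an edge a, and let C be closed under predecessors in the residual digraph of y on B ∖ a,
-- whose arcs are the orientations of edges carrying a nonzero value.  An edge e ≠ a crossing C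
-- then carries nothing into C and, as y is at least 1 on e, at least 1 out of C.  Hence a carries
-- a nonnegative amount into C, and at least 1 if C separates its endpoints and a is no bridge.
-- Now let C be the set of vertices reaching one endpoint of a.  If a is a bridge, neither endpoint
-- reaches the other, which forces yf a = yb a, and a can be given (½, ½).  Otherwise, if yf a ≠ 0,
-- either hd a reaches tl a and pushing flow around the cycle this closes lets yb a be cancelled,
-- or yb a - yf a ≥ 1 and yf a can be cancelled.  Each step stays in P and shrinks the support, so
-- the edges can be settled one after another.

open import Defs
open import Data.Empty using (⊥-elim)
open import Data.Fin using (Fin; zero; suc)
open import Data.Fin.Properties using (_≟_; any?)
open import Data.Nat using (ℕ; zero; suc)
open import Data.Product using (_×_; _,_; proj₁; proj₂; ∃; ∃-syntax; Σ-syntax)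
open import Data.Sum using (_⊎_; inj₁; inj₂)
open import Function using (_∘_; const; id)
open import Level using (Level)
open import Relation.Binary using (Rel; Decidable)
open import Relation.Binary.Construct.Closure.ReflexiveTransitive using (Star; ε; _◅_)
open import Relation.Binary.PropositionalEquality
  using (_≡_; _≢_; refl; sym; trans; cong; cong₂; subst; subst₂; module ≡-Reasoning)
open import Relation.Nullary using (Dec; yes; no; does; ¬_; ¬?)
open import Relation.Nullary.Decidable
  using (map′; _×-dec_; _⊎-dec_; dec-true; dec-false; decidable-stable)
open import Relation.Unary using (Pred)
import Relation.Unary as Unary

module FiniteReachability {n : ℕ} {ℓ : Level} {R : Rel (Fin n) ℓ} (R? : Decidable R) where

  open import Data.Fin.Subset using (Subset; _∈_; ⁅_⁆; _∪_; ∣_∣)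
  open import Data.Fin.Subset.Properties
    using (_∈?_; x∈⁅x⁆; x∈⁅y⁆⇒x≡y; x∈p∪q⁺; x∈p∪q⁻; p⊆p∪q; p⊂q⇒∣p∣<∣q∣; ∣p∣≤n; ∣p∣≡n⇒p≡⊤; ∈⊤)
  open import Data.Nat using (_≤_; _+_)
  import Data.Nat.Properties as ℕ

  PredecessorClosed : Subset n → Set ℓ
  PredecessorClosed X = ∀ {u v} → R u v → v ∈ X → u ∈ X

  record Reachers (t : Fin n) : Set ℓ where
    field
      members : Subset n
      target  : t ∈ members
      closed  : PredecessorClosed members
      sound   : ∀ {v} → v ∈ members → Star R v t

  -- The fuel m bounds the number of vertices missing from X: each round either finds X closed
  -- or adds a vertex to it.
  saturate : ∀ {t} m (X : Subset n) → n ≤ m + ∣ X ∣ → t ∈ X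
           → (∀ {v} → v ∈ X → Star R v t) → Reachers t
  saturate zero X full t∈X sound =
    record { members = X ; target = t∈X ; closed = λ _ _ → everything ; sound = sound }
    where
    everything : ∀ {u} → u ∈ X
    everything {u} = subst (u ∈_) (sym (∣p∣≡n⇒p≡⊤ (ℕ.≤-antisym (∣p∣≤n X) full))) ∈⊤
  saturate (suc m) X bound t∈X sound
    with any? (λ u → ¬? (u ∈? X) ×-dec any? (λ v → R? u v ×-dec v ∈? X))
  ... | yes (u , u∉X , v , uRv , v∈X) = saturate m (X ∪ ⁅ u ⁆) bound′ (p⊆p∪q _ t∈X) sound′
    where
    bound′ : n ≤ m + ∣ X ∪ ⁅ u ⁆ ∣
    bound′ = begin
      n                  ≤⟨ bound ⟩
      suc m + ∣ X ∣      ≡⟨ ℕ.+-suc m _ ⟨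
      m + suc ∣ X ∣      ≤⟨ ℕ.+-monoʳ-≤ m (p⊂q⇒∣p∣<∣q∣ (p⊆p∪q _ , u , x∈p∪q⁺ (inj₂ (x∈⁅x⁆ u)) , u∉X)) ⟩
      m + ∣ X ∪ ⁅ u ⁆ ∣  ∎
      where open ℕ.≤-Reasoning
    sound′ : ∀ {w} → w ∈ X ∪ ⁅ u ⁆ → Star R w _
    sound′ w∈ with x∈p∪q⁻ X ⁅ u ⁆ w∈
    ... | inj₁ w∈X = sound w∈X
    ... | inj₂ w∈u rewrite x∈⁅y⁆⇒x≡y u w∈u = uRv ◅ sound v∈X
  ... | no no-escape = record { members = X ; target = t∈X ; closed = closed ; sound = sound }
    where
    closed : PredecessorClosed X
    closed {u} {v} uRv v∈X with u ∈? X
    ... | yes u∈X = u∈X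
    ... | no  u∉X = ⊥-elim (no-escape (u , u∉X , v , uRv , v∈X))

  reachers : ∀ t → Reachers t
  reachers t = saturate n ⁅ t ⁆ (ℕ.m≤m+n n _) (x∈⁅x⁆ t)
                 (λ v∈⁅t⁆ → subst (λ v → Star R v t) (sym (x∈⁅y⁆⇒x≡y t v∈⁅t⁆)) ε)

  star? : Decidable (Star R)
  star? u t = map′ sound complete (u ∈? members)
    where
    open Reachers (reachers t)
    complete : ∀ {v} → Star R v t → v ∈ members
    complete ε       = target
    complete (r ◅ p) = closed r (complete p)

module Rationals where

  open import Algebra.Bundles using (CommutativeRing)
  open import Data.Bool using (true; false; if_then_else_)
  open import Data.Fin using (punchIn; punchOut)
  open import Data.Fin.Properties using (punchInᵢ≢i; punchIn-punchOut)
  open import Data.Rational using (ℚ; 0ℚ; 1ℚ; ½; _+_; _-_; -_; _*_; _≤_; nonNegative)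
  import Data.Rational.Properties as ℚ
  open import Data.Rational.Solver using (module +-*-Solver)
  open +-*-Solver using (solve; _:+_; _:-_; _:*_; _:=_)
  open import Data.Unit using (tt)
  open import Data.Vec.Functional using (removeAt)

  open import Algebra.Properties.Semiring.Sum (CommutativeRing.semiring ℚ.+-*-commutativeRing) public
    using ( sum; sum-cong-≗; sum-replicate-zero; sum-remove
          ; ∑-distrib-+; ∑-comm; *-distribˡ-sum; *-distribʳ-sum)
  open import Algebra.Properties.Ring ℚ.+-*-ring public using (-1*x≈-x)
  open import Algebra.Properties.AbelianGroup ℚ.+-0-abelianGroup public using (⁻¹-anti-homo‿-)

  1≰0 : ¬ (1ℚ ≤ 0ℚ)
  1≰0 = ℚ.≤⇒≤ᵇ

  0≤1 : 0ℚ ≤ 1ℚ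
  0≤1 = ℚ.≤ᵇ⇒≤ tt

  -1≤0 : - 1ℚ ≤ 0ℚ
  -1≤0 = ℚ.≤ᵇ⇒≤ tt

  0≤½ : 0ℚ ≤ ½
  0≤½ = ℚ.≤ᵇ⇒≤ tt

  p-q+q≡p : ∀ p q → p - q + q ≡ p
  p-q+q≡p = solve 2 (λ p q → p :- q :+ q := p) refl

  0≤p-q⇒q≤p : ∀ {p q} → 0ℚ ≤ p - q → q ≤ p
  0≤p-q⇒q≤p {p} {q} 0≤p-q = begin
    q          ≡⟨ ℚ.+-identityˡ q ⟨
    0ℚ + q     ≤⟨ ℚ.+-monoˡ-≤ q 0≤p-q ⟩
    p - q + q  ≡⟨ p-q+q≡p p q ⟩
    p          ∎
    where open ℚ.≤-Reasoning

  p≤p+q : ∀ p {q} → 0ℚ ≤ q → p ≤ p + q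
  p≤p+q p {q} 0≤q = subst (_≤ p + q) (ℚ.+-identityʳ p) (ℚ.+-monoʳ-≤ p 0≤q)

  *-nonneg : ∀ {p q} → 0ℚ ≤ p → 0ℚ ≤ q → 0ℚ ≤ p * q
  *-nonneg {p} {q} 0≤p 0≤q =
    ℚ.nonNegative⁻¹ (p * q) {{ℚ.nonNeg*nonNeg⇒nonNeg p {{nonNegative 0≤p}} q {{nonNegative 0≤q}}}}

  *-distribˡ-- : ∀ c p q → c * (p - q) ≡ c * p - c * q
  *-distribˡ-- = solve 3 (λ c p q → c :* (p :- q) := c :* p :- c :* q) refl

  +-interchange-- : ∀ p q r s → (p + r) - (q + s) ≡ (p - q) + (r - s)
  +-interchange-- = solve 4 (λ p q r s → (p :+ r) :- (q :+ s) := (p :- q) :+ (r :- s)) refl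

  telescope : ∀ p q r → (q - p) + (r - q) ≡ r - p
  telescope = solve 3 (λ p q r → (q :- p) :+ (r :- q) := r :- p) refl

  0-p≡-1*p : ∀ p → 0ℚ - p ≡ - 1ℚ * p
  0-p≡-1*p p = trans (ℚ.+-identityˡ (- p)) (sym (-1*x≈-x p))

  -1*[p-q]≡q-p : ∀ p q → (0ℚ - 1ℚ) * (p - q) ≡ q - p
  -1*[p-q]≡q-p p q = trans (-1*x≈-x (p - q)) (⁻¹-anti-homo‿- p q)

  δ : ∀ {m} → Fin m → Fin m → ℚ
  δ i j = if does (i ≟ j) then 1ℚ else 0ℚ

  δ-refl : ∀ {m} (i : Fin m) → δ i i ≡ 1ℚ
  δ-refl i rewrite dec-true (i ≟ i) refl = refl

  δ-≢ : ∀ {m} {i j : Fin m} → i ≢ j → δ i j ≡ 0ℚ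
  δ-≢ {i = i} {j} i≢j rewrite dec-false (i ≟ j) i≢j = refl

  δ-nonneg : ∀ {m} (i j : Fin m) → 0ℚ ≤ δ i j
  δ-nonneg i j with does (i ≟ j)
  ... | true  = 0≤1
  ... | false = ℚ.≤-refl

  Σℚ≡sum : ∀ {m} (f : Fin m → ℚ) → Σℚ f ≡ sum f
  Σℚ≡sum {zero}  f = refl
  Σℚ≡sum {suc m} f = cong (f zero +_) (Σℚ≡sum (f ∘ suc))

  sum-neg : ∀ {m} (f : Fin m → ℚ) → sum (λ i → - f i) ≡ - sum f
  sum-neg {zero}  f = refl
  sum-neg {suc m} f = trans (cong (- f zero +_) (sum-neg (f ∘ suc))) (sym (ℚ.neg-distrib-+ (f zero) _))

  sum-sub : ∀ {m} (f g : Fin m → ℚ) → sum (λ i → f i - g i) ≡ sum f - sum g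
  sum-sub f g = trans (∑-distrib-+ f (λ i → - g i)) (cong (sum f +_) (sum-neg g))

  sum-δ : ∀ {m} (f : Fin m → ℚ) j → sum (λ i → f i * δ i j) ≡ f j
  sum-δ {suc m} f zero = begin
    f zero * 1ℚ + sum (λ i → f (suc i) * 0ℚ)  ≡⟨ cong₂ _+_ (ℚ.*-identityʳ (f zero))
                                                            (sum-cong-≗ (ℚ.*-zeroʳ ∘ f ∘ suc)) ⟩
    f zero + sum {m} (const 0ℚ)               ≡⟨ cong (f zero +_) (sum-replicate-zero m) ⟩
    f zero + 0ℚ                               ≡⟨ ℚ.+-identityʳ (f zero) ⟩
    f zero                                    ∎
    where open ≡-Reasoning
  sum-δ {suc m} f (suc j) =
    trans (cong₂ _+_ (ℚ.*-zeroʳ (f zero)) (sum-δ (f ∘ suc) j)) (ℚ.+-identityˡ (f (suc j)))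

  sum-nonpos : ∀ {m} (f : Fin m → ℚ) → (∀ i → f i ≤ 0ℚ) → sum f ≤ 0ℚ
  sum-nonpos {zero}  f f≤0 = ℚ.≤-refl
  sum-nonpos {suc m} f f≤0 = ℚ.+-mono-≤ (f≤0 zero) (sum-nonpos (f ∘ suc) (f≤0 ∘ suc))

  sum≤at : ∀ {m} (f : Fin m → ℚ) a → (∀ i → i ≢ a → f i ≤ 0ℚ) → sum f ≤ f a
  sum≤at {suc m} f a f≤0 = begin
    sum f                     ≡⟨ sum-remove f ⟩
    f a + sum (removeAt f a)  ≤⟨ ℚ.+-monoʳ-≤ (f a) (sum-nonpos (removeAt f a) others≤0) ⟩
    f a + 0ℚ                  ≡⟨ ℚ.+-identityʳ (f a) ⟩
    f a                       ∎
    where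
    open ℚ.≤-Reasoning
    others≤0 = λ i → f≤0 (punchIn a i) (punchInᵢ≢i a i)

  sum≤at₂ : ∀ {m} (f : Fin m → ℚ) a b → b ≢ a → (∀ i → i ≢ a → f i ≤ 0ℚ) → sum f ≤ f a + f b
  sum≤at₂ {suc m} f a b b≢a f≤0 = begin
    sum f                     ≡⟨ sum-remove f ⟩
    f a + sum (removeAt f a)  ≤⟨ ℚ.+-monoʳ-≤ (f a) (sum≤at (removeAt f a) j λ i _ → f≤0 _ (punchInᵢ≢i a i)) ⟩
    f a + f (punchIn a j)     ≡⟨ cong (λ e → f a + f e) (punchIn-punchOut (b≢a ∘ sym)) ⟩
    f a + f b                 ∎
    where
    open ℚ.≤-Reasoning
    j = punchOut (b≢a ∘ sym)

module FlowPolyhedron {n k : ℕ} (S : Setup n k) where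

  open import Algebra.Bundles using (CommutativeMonoid)
  open import Data.Bool using (if_then_else_)
  open import Data.List using (List; []; _∷_)
  open import Data.List.Relation.Unary.All as All using (All; []; _∷_)
  open import Data.Rational using (ℚ; 0ℚ; 1ℚ; ½; _+_; _-_; -_; _*_; _≤_; _⊓_)
  import Data.Rational.Properties as ℚ
  open import Algebra.Properties.CommutativeSemigroup
    (CommutativeMonoid.commutativeSemigroup ℚ.*-1-commutativeMonoid) using (x∙yz≈y∙xz)
  open import Data.Rational.Solver using (module +-*-Solver)
  open +-*-Solver using (solve; _:+_; _:-_; _:*_; _:=_; con)
  import Data.Sum as Sum
  open import Data.Vec.Functional using (updateAt)
  open import Data.Vec.Functional.Properties using (updateAt-updates; updateAt-minimal)
  open Rationals

  net : (Fin k → ℚ) → (Fin k → ℚ) → Fin k → ℚ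
  net yf yb e = yf e - yb e

  excess : (Fin k → ℚ) → Fin n → ℚ
  excess z v = sum (λ e → inc S v e * z e)

  Circulation : (Fin k → ℚ) → Set
  Circulation z = ∀ v → excess z v ≡ 0ℚ

  rowv≡excess : ∀ yf yb v → rowv S yf yb v ≡ excess (net yf yb) v
  rowv≡excess yf yb v = begin
    rowv S yf yb v
      ≡⟨ cong₂ _-_ (Σℚ≡sum (λ e → inc S v e * yf e)) (Σℚ≡sum (λ e → inc S v e * yb e)) ⟩
    sum (λ e → inc S v e * yf e) - sum (λ e → inc S v e * yb e)
      ≡⟨ sum-sub (λ e → inc S v e * yf e) (λ e → inc S v e * yb e) ⟨
    sum (λ e → inc S v e * yf e - inc S v e * yb e)
      ≡⟨ sum-cong-≗ (λ e → *-distribˡ-- (inc S v e) (yf e) (yb e)) ⟨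
    excess (net yf yb) v
      ∎
    where open ≡-Reasoning

  excess-cong : ∀ {z w} → (∀ e → z e ≡ w e) → ∀ v → excess z v ≡ excess w v
  excess-cong z≗w v = sum-cong-≗ (λ e → cong (inc S v e *_) (z≗w e))

  excess-+ : ∀ z w v → excess (λ e → z e + w e) v ≡ excess z v + excess w v
  excess-+ z w v = trans (sum-cong-≗ (λ e → ℚ.*-distribˡ-+ (inc S v e) (z e) (w e)))
                         (∑-distrib-+ (λ e → inc S v e * z e) (λ e → inc S v e * w e))

  excess-* : ∀ c z v → excess (λ e → c * z e) v ≡ c * excess z v
  excess-* c z v = trans (sum-cong-≗ (λ e → x∙yz≈y∙xz (inc S v e) c (z e)))
                         (sym (*-distribˡ-sum c (λ e → inc S v e * z e)))

  inc≡δ-δ : ∀ v e → inc S v e ≡ δ v (hd S e) - δ v (tl S e)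
  inc≡δ-δ v e with v ≟ hd S e | v ≟ tl S e
  ... | yes _ | yes _ = refl
  ... | yes _ | no  _ = refl
  ... | no  _ | yes _ = refl
  ... | no  _ | no  _ = refl

  excess-δ : ∀ e v → excess (λ i → δ i e) v ≡ δ v (hd S e) - δ v (tl S e)
  excess-δ e v = trans (sum-δ (inc S v) e) (inc≡δ-δ v e)

  -- For π the indicator of a vertex set C, flux π z e is the flow of z into C along e.
  flux : (Fin n → ℚ) → (Fin k → ℚ) → Fin k → ℚ
  flux π z e = (π (hd S e) - π (tl S e)) * z e

  sum-inc : ∀ (π : Fin n → ℚ) e → sum (λ v → π v * inc S v e) ≡ π (hd S e) - π (tl S e)
  sum-inc π e = begin
    sum (λ v → π v * inc S v e)
      ≡⟨ sum-cong-≗ (λ v → trans (cong (π v *_) (inc≡δ-δ v e)) (*-distribˡ-- (π v) _ _)) ⟩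
    sum (λ v → π v * δ v (hd S e) - π v * δ v (tl S e))
      ≡⟨ sum-sub (λ v → π v * δ v (hd S e)) (λ v → π v * δ v (tl S e)) ⟩
    sum (λ v → π v * δ v (hd S e)) - sum (λ v → π v * δ v (tl S e))
      ≡⟨ cong₂ _-_ (sum-δ π (hd S e)) (sum-δ π (tl S e)) ⟩
    π (hd S e) - π (tl S e)
      ∎
    where open ≡-Reasoning

  summation-by-parts : ∀ (π : Fin n → ℚ) z → sum (λ v → π v * excess z v) ≡ sum (flux π z)
  summation-by-parts π z = begin
    sum (λ v → π v * excess z v)
      ≡⟨ sum-cong-≗ (λ v → *-distribˡ-sum (π v) (λ e → inc S v e * z e)) ⟩
    sum (λ v → sum (λ e → π v * (inc S v e * z e)))
      ≡⟨ ∑-comm {n} {k} (λ v e → π v * (inc S v e * z e)) ⟩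
    sum (λ e → sum (λ v → π v * (inc S v e * z e)))
      ≡⟨ sum-cong-≗ {k} (λ e → sum-cong-≗ {n} (λ v → sym (ℚ.*-assoc (π v) _ _))) ⟩
    sum (λ e → sum (λ v → π v * inc S v e * z e))
      ≡⟨ sum-cong-≗ (λ e → sym (*-distribʳ-sum (z e) (λ v → π v * inc S v e))) ⟩
    sum (λ e → sum (λ v → π v * inc S v e) * z e)
      ≡⟨ sum-cong-≗ (λ e → cong (_* z e) (sum-inc π e)) ⟩
    sum (flux π z)
      ∎
    where open ≡-Reasoning

  circulation-flux : ∀ (π : Fin n → ℚ) {z} → Circulation z → sum (flux π z) ≡ 0ℚ
  circulation-flux π {z} circ = begin
    sum (flux π z)                ≡⟨ summation-by-parts π z ⟨
    sum (λ v → π v * excess z v)  ≡⟨ sum-cong-≗ (λ v → trans (cong (π v *_) (circ v)) (ℚ.*-zeroʳ (π v))) ⟩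
    sum {n} (const 0ℚ)            ≡⟨ sum-replicate-zero n ⟩
    0ℚ                            ∎
    where open ≡-Reasoning

  InP⇒circulation : ∀ {yf yb} → InP S yf yb → Circulation (net yf yb)
  InP⇒circulation (rows , _) v = trans (sym (rowv≡excess _ _ v)) (rows v)

  InP⇒covered : ∀ {yf yb} → InP S yf yb → ∀ e → 1ℚ ≤ yf e + yb e
  InP⇒covered = proj₁ ∘ proj₂

  InP-intro : ∀ {yf yb yf′ yb′} → InP S yf yb → SuppSub yf′ yb′ yf yb
            → Circulation (net yf′ yb′) → (∀ e → 1ℚ ≤ yf′ e + yb′ e)
            → (∀ e → 0ℚ ≤ yf′ e) → (∀ e → 0ℚ ≤ yb′ e) → InP S yf′ yb′
  InP-intro (_ , _ , no-fwd , no-bwd , _) (suppf , suppb) circ covered nonnegf nonnegb =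
      (λ v → trans (rowv≡excess _ _ v) (circ v))
    , covered , (λ e → suppf e ∘ no-fwd e) , (λ e → suppb e ∘ no-bwd e) , nonnegf , nonnegb

  SuppSub-refl : ∀ {yf yb : Fin k → ℚ} → SuppSub yf yb yf yb
  SuppSub-refl = (λ _ → id) , (λ _ → id)

  SuppSub-trans : ∀ {zf zb yf yb xf xb : Fin k → ℚ}
                → SuppSub zf zb yf yb → SuppSub yf yb xf xb → SuppSub zf zb xf xb
  SuppSub-trans (zf⊆yf , zb⊆yb) (yf⊆xf , yb⊆xb) = (λ e → zf⊆yf e ∘ yf⊆xf e) , (λ e → zb⊆yb e ∘ yb⊆xb e)

  Refinement : (yf yb : Fin k → ℚ) → ((Fin k → ℚ) → (Fin k → ℚ) → Set) → Set
  Refinement yf yb P =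
    Σ[ yf′ ∈ (Fin k → ℚ) ] Σ[ yb′ ∈ (Fin k → ℚ) ] (InP S yf′ yb′ × SuppSub yf′ yb′ yf yb × P yf′ yb′)

  unchanged : ∀ {yf yb} {P : (Fin k → ℚ) → (Fin k → ℚ) → Set} → InP S yf yb → P yf yb → Refinement yf yb P
  unchanged {yf} {yb} y∈P p = yf , yb , y∈P , SuppSub-refl , p

  refine-map : ∀ {yf yb} {P Q : (Fin k → ℚ) → (Fin k → ℚ) → Set}
             → (∀ {yf′ yb′} → P yf′ yb′ → Q yf′ yb′) → Refinement yf yb P → Refinement yf yb Q
  refine-map f (yf′ , yb′ , y′∈P , y′⊆y , p) = yf′ , yb′ , y′∈P , y′⊆y , f p

  refine-bind : ∀ {yf yb} {P Q : (Fin k → ℚ) → (Fin k → ℚ) → Set} → Refinement yf yb P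
              → (∀ {yf′ yb′} → InP S yf′ yb′ → P yf′ yb′ → Refinement yf′ yb′ Q) → Refinement yf yb Q
  refine-bind (yf′ , yb′ , y′∈P , y′⊆y , p) next with next y′∈P p
  ... | yf″ , yb″ , y″∈P , y″⊆y′ , q = yf″ , yb″ , y″∈P , SuppSub-trans y″⊆y′ y′⊆y , q

  record Refines (p q p′ q′ : ℚ) : Set where
    field
      same-net : p′ - q′ ≡ p - q
      nonnegˡ  : 0ℚ ≤ p′
      nonnegʳ  : 0ℚ ≤ q′
      covered  : 1ℚ ≤ p′ + q′
      suppˡ    : p ≡ 0ℚ → p′ ≡ 0ℚ
      suppʳ    : q ≡ 0ℚ → q′ ≡ 0ℚ

  Refines-refl : ∀ {yf yb} → InP S yf yb → ∀ e → Refines (yf e) (yb e) (yf e) (yb e)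
  Refines-refl (_ , covered , _ , _ , nonnegf , nonnegb) e = record
    { same-net = refl ; nonnegˡ = nonnegf e ; nonnegʳ = nonnegb e ; covered = covered e
    ; suppˡ = id ; suppʳ = id }

  refine : ∀ {yf yb yf′ yb′} → InP S yf yb → (∀ e → Refines (yf e) (yb e) (yf′ e) (yb′ e))
         → InP S yf′ yb′ × SuppSub yf′ yb′ yf yb
  refine y∈P r = InP-intro y∈P supp circ (covered ∘ r) (nonnegˡ ∘ r) (nonnegʳ ∘ r) , supp
    where
    open Refines
    supp = (suppˡ ∘ r) , (suppʳ ∘ r)
    circ = λ v → trans (excess-cong (same-net ∘ r) v) (InP⇒circulation y∈P v)

  refine-at : ∀ {yf yb p q} → InP S yf yb → ∀ a → Refines (yf a) (yb a) p q
            → Refinement yf yb (λ yf′ yb′ → yf′ a ≡ p × yb′ a ≡ q)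
  refine-at {yf} {yb} {p} {q} y∈P a r =
    yf′ , yb′ , proj₁ refined , proj₂ refined , updateAt-updates a yf , updateAt-updates a yb
    where
    yf′ = updateAt yf a (const p)
    yb′ = updateAt yb a (const q)
    r′ : ∀ e → Refines (yf e) (yb e) (yf′ e) (yb′ e)
    r′ e with e ≟ a
    ... | yes refl = subst₂ (Refines (yf e) (yb e))
                            (sym (updateAt-updates e yf)) (sym (updateAt-updates e yb)) r
    ... | no  e≢a  = subst₂ (Refines (yf e) (yb e))
                            (sym (updateAt-minimal e a yf e≢a)) (sym (updateAt-minimal e a yb e≢a))
                            (Refines-refl y∈P e)
    refined = refine y∈P r′

  cancelʳ : ∀ {p q} → 0ℚ ≤ q → 1ℚ ≤ p - q → Refines p q (p - q) 0ℚ
  cancelʳ {p} {q} 0≤q 1≤p-q = record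
    { same-net = ℚ.+-identityʳ (p - q)
    ; nonnegˡ  = ℚ.≤-trans 0≤1 1≤p-q
    ; nonnegʳ  = ℚ.≤-refl
    ; covered  = subst (1ℚ ≤_) (sym (ℚ.+-identityʳ (p - q))) 1≤p-q
    ; suppˡ    = λ { refl → ⊥-elim (1≰0 (ℚ.≤-trans 1≤p-q 0-q≤0)) }
    ; suppʳ    = λ _ → refl
    }
    where
    0-q≤0 : 0ℚ - q ≤ 0ℚ
    0-q≤0 = subst (_≤ 0ℚ) (sym (ℚ.+-identityˡ (- q))) (ℚ.neg-antimono-≤ 0≤q)

  cancelˡ : ∀ {p q} → 0ℚ ≤ p → 1ℚ ≤ q - p → Refines p q 0ℚ (q - p)
  cancelˡ {p} {q} 0≤p 1≤q-p = record
    { same-net = trans (ℚ.+-identityˡ (- (q - p))) (⁻¹-anti-homo‿- q p)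
    ; nonnegˡ  = ℚ.≤-refl
    ; nonnegʳ  = ℚ.≤-trans 0≤1 1≤q-p
    ; covered  = subst (1ℚ ≤_) (sym (ℚ.+-identityˡ (q - p))) 1≤q-p
    ; suppˡ    = λ _ → refl
    ; suppʳ    = λ { refl → ⊥-elim (1≰0 (ℚ.≤-trans 1≤q-p 0-p≤0)) }
    }
    where
    0-p≤0 : 0ℚ - p ≤ 0ℚ
    0-p≤0 = subst (_≤ 0ℚ) (sym (ℚ.+-identityˡ (- p))) (ℚ.neg-antimono-≤ 0≤p)

  halve : ∀ {p} → 1ℚ ≤ p + p → Refines p p ½ ½
  halve {p} 1≤2p = record
    { same-net = sym (ℚ.+-inverseʳ p)
    ; nonnegˡ  = 0≤½
    ; nonnegʳ  = 0≤½
    ; covered  = ℚ.≤-refl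
    ; suppˡ    = p≡0⇒½≡0
    ; suppʳ    = p≡0⇒½≡0
    }
    where
    p≡0⇒½≡0 : p ≡ 0ℚ → ½ ≡ 0ℚ
    p≡0⇒½≡0 refl = ⊥-elim (1≰0 1≤2p)

  cancel-backward : ∀ {yf yb} → InP S yf yb → ∀ a → 1ℚ ≤ yf a - yb a
                  → Refinement yf yb (λ _ yb′ → yb′ a ≡ 0ℚ)
  cancel-backward y∈P@(_ , _ , _ , _ , _ , nonnegb) a gap =
    refine-map proj₂ (refine-at y∈P a (cancelʳ (nonnegb a) gap))

  cancel-forward : ∀ {yf yb} → InP S yf yb → ∀ a → 1ℚ ≤ yb a - yf a
                 → Refinement yf yb (λ yf′ _ → yf′ a ≡ 0ℚ)
  cancel-forward y∈P@(_ , _ , _ , _ , nonnegf , _) a gap =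
    refine-map proj₁ (refine-at y∈P a (cancelˡ (nonnegf a) gap))

  record Flow (yf yb : Fin k → ℚ) (u v : Fin n) : Set where
    field
      ff fb     : Fin k → ℚ
      nonnegf   : ∀ e → 0ℚ ≤ ff e
      nonnegb   : ∀ e → 0ℚ ≤ fb e
      supported : SuppSub ff fb yf yb
      conserves : ∀ w → excess (net ff fb) w ≡ δ w v - δ w u

  module _ {yf yb : Fin k → ℚ} where

    empty-flow : ∀ {u} → Flow yf yb u u
    empty-flow {u} = record
      { ff = const 0ℚ ; fb = const 0ℚ
      ; nonnegf = λ _ → ℚ.≤-refl ; nonnegb = λ _ → ℚ.≤-refl
      ; supported = (λ _ _ → refl) , (λ _ _ → refl)
      ; conserves = λ w → begin
          sum (λ e → inc S w e * 0ℚ)  ≡⟨ sum-cong-≗ (ℚ.*-zeroʳ ∘ inc S w) ⟩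
          sum {k} (const 0ℚ)          ≡⟨ sum-replicate-zero k ⟩
          0ℚ                          ≡⟨ ℚ.+-inverseʳ (δ w u) ⟨
          δ w u - δ w u               ∎
      }
      where open ≡-Reasoning

    forward-flow : ∀ e → yf e ≢ 0ℚ → Flow yf yb (tl S e) (hd S e)
    forward-flow e yf≢0 = record
      { ff = λ i → δ i e ; fb = const 0ℚ
      ; nonnegf = λ i → δ-nonneg i e ; nonnegb = λ _ → ℚ.≤-refl
      ; supported = (λ i yf≡0 → δ-≢ {i = i} λ { refl → yf≢0 yf≡0 }) , (λ _ _ → refl)
      ; conserves = λ w → trans (excess-cong (λ i → ℚ.+-identityʳ (δ i e)) w) (excess-δ e w)
      }

    backward-flow : ∀ e → yb e ≢ 0ℚ → Flow yf yb (hd S e) (tl S e)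
    backward-flow e yb≢0 = record
      { ff = const 0ℚ ; fb = λ i → δ i e
      ; nonnegf = λ _ → ℚ.≤-refl ; nonnegb = λ i → δ-nonneg i e
      ; supported = (λ _ _ → refl) , (λ i yb≡0 → δ-≢ {i = i} λ { refl → yb≢0 yb≡0 })
      ; conserves = λ w → begin
          excess (λ i → 0ℚ - δ i e) w                ≡⟨ excess-cong (λ i → 0-p≡-1*p (δ i e)) w ⟩
          excess (λ i → - 1ℚ * δ i e) w              ≡⟨ excess-* (- 1ℚ) (λ i → δ i e) w ⟩
          - 1ℚ * excess (λ i → δ i e) w              ≡⟨ cong (- 1ℚ *_) (excess-δ e w) ⟩
          (0ℚ - 1ℚ) * (δ w (hd S e) - δ w (tl S e))  ≡⟨ -1*[p-q]≡q-p (δ w (hd S e)) (δ w (tl S e)) ⟩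
          δ w (tl S e) - δ w (hd S e)                ∎
      }
      where open ≡-Reasoning

    _⊕_ : ∀ {u v w} → Flow yf yb u v → Flow yf yb v w → Flow yf yb u w
    _⊕_ {u} {v} {w} f g = record
      { ff = λ i → f.ff i + g.ff i ; fb = λ i → f.fb i + g.fb i
      ; nonnegf = λ i → ℚ.+-mono-≤ (f.nonnegf i) (g.nonnegf i)
      ; nonnegb = λ i → ℚ.+-mono-≤ (f.nonnegb i) (g.nonnegb i)
      ; supported = (λ i yf≡0 → cong₂ _+_ (proj₁ f.supported i yf≡0) (proj₁ g.supported i yf≡0))
                  , (λ i yb≡0 → cong₂ _+_ (proj₂ f.supported i yb≡0) (proj₂ g.supported i yb≡0))
      ; conserves = λ x → begin
          excess (net (λ i → f.ff i + g.ff i) (λ i → f.fb i + g.fb i)) x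
            ≡⟨ excess-cong (λ i → +-interchange-- (f.ff i) (f.fb i) (g.ff i) (g.fb i)) x ⟩
          excess (λ i → net f.ff f.fb i + net g.ff g.fb i) x
            ≡⟨ excess-+ (net f.ff f.fb) (net g.ff g.fb) x ⟩
          excess (net f.ff f.fb) x + excess (net g.ff g.fb) x
            ≡⟨ cong₂ _+_ (f.conserves x) (g.conserves x) ⟩
          (δ x v - δ x u) + (δ x w - δ x v)
            ≡⟨ telescope (δ x u) (δ x v) (δ x w) ⟩
          δ x w - δ x u
            ∎
      }
      where
      module f = Flow f
      module g = Flow g
      open ≡-Reasoning

  add-circulation : ∀ {yf yb u c} → InP S yf yb → (h : Flow yf yb u u) → 0ℚ ≤ c
    → let open Flow h in
      InP S (λ e → yf e + c * ff e) (λ e → yb e + c * fb e)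
    × SuppSub (λ e → yf e + c * ff e) (λ e → yb e + c * fb e) yf yb
  add-circulation {yf} {yb} {u} {c} y∈P@(_ , covered , _ , _ , nonnegyf , nonnegyb) h 0≤c =
    InP-intro y∈P supp circ covered′ (λ e → ℚ.≤-trans (nonnegyf e) (grow (yf e) (nonnegf e)))
                                     (λ e → ℚ.≤-trans (nonnegyb e) (grow (yb e) (nonnegb e)))
    , supp
    where
    open Flow h
    grow : ∀ p {x} → 0ℚ ≤ x → p ≤ p + c * x
    grow p 0≤x = p≤p+q p (*-nonneg 0≤c 0≤x)
    vanish : ∀ {p x} → p ≡ 0ℚ → x ≡ 0ℚ → p + c * x ≡ 0ℚ
    vanish refl refl = cong (0ℚ +_) (ℚ.*-zeroʳ c)
    supp = (λ e yf≡0 → vanish yf≡0 (proj₁ supported e yf≡0))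
         , (λ e yb≡0 → vanish yb≡0 (proj₂ supported e yb≡0))
    covered′ : ∀ e → 1ℚ ≤ (yf e + c * ff e) + (yb e + c * fb e)
    covered′ e = ℚ.≤-trans (covered e) (ℚ.+-mono-≤ (grow (yf e) (nonnegf e)) (grow (yb e) (nonnegb e)))
    circ : Circulation (net (λ e → yf e + c * ff e) (λ e → yb e + c * fb e))
    circ v = begin
      excess (net (λ e → yf e + c * ff e) (λ e → yb e + c * fb e)) v
        ≡⟨ excess-cong (λ e → +-interchange-- (yf e) (yb e) (c * ff e) (c * fb e)) v ⟩
      excess (λ e → net yf yb e + (c * ff e - c * fb e)) v
        ≡⟨ excess-+ (net yf yb) (λ e → c * ff e - c * fb e) v ⟩
      excess (net yf yb) v + excess (λ e → c * ff e - c * fb e) v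
        ≡⟨ cong (excess (net yf yb) v +_) (excess-cong (λ e → sym (*-distribˡ-- c (ff e) (fb e))) v) ⟩
      excess (net yf yb) v + excess (λ e → c * net ff fb e) v
        ≡⟨ cong₂ _+_ (InP⇒circulation y∈P v) (excess-* c (net ff fb) v) ⟩
      0ℚ + c * excess (net ff fb) v
        ≡⟨ cong (λ x → 0ℚ + c * x) (trans (conserves v) (ℚ.+-inverseʳ (δ v u))) ⟩
      0ℚ + c * 0ℚ
        ≡⟨ cong (0ℚ +_) (ℚ.*-zeroʳ c) ⟩
      0ℚ
        ∎
      where open ≡-Reasoning

  data Residual (yf yb : Fin k → ℚ) (a : Fin k) : Fin n → Fin n → Set where
    forward  : ∀ e → e ≢ a → yf e ≢ 0ℚ → Residual yf yb a (tl S e) (hd S e)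
    backward : ∀ e → e ≢ a → yb e ≢ 0ℚ → Residual yf yb a (hd S e) (tl S e)

  module _ {yf yb : Fin k → ℚ} {a : Fin k} where

    residual? : Decidable (Residual yf yb a)
    residual? u v = map′ from to (any? λ e → forward? e ⊎-dec backward? e)
      where
      Forward Backward : Fin k → Set
      Forward e  = e ≢ a × yf e ≢ 0ℚ × tl S e ≡ u × hd S e ≡ v
      Backward e = e ≢ a × yb e ≢ 0ℚ × hd S e ≡ u × tl S e ≡ v
      forward? : ∀ e → Dec (Forward e)
      forward? e = ¬? (e ≟ a) ×-dec ¬? (yf e ℚ.≟ 0ℚ) ×-dec tl S e ≟ u ×-dec hd S e ≟ v
      backward? : ∀ e → Dec (Backward e)
      backward? e = ¬? (e ≟ a) ×-dec ¬? (yb e ℚ.≟ 0ℚ) ×-dec hd S e ≟ u ×-dec tl S e ≟ v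
      from : ∃ (λ e → Forward e ⊎ Backward e) → Residual yf yb a u v
      from (e , inj₁ (e≢a , yf≢0 , refl , refl)) = forward e e≢a yf≢0
      from (e , inj₂ (e≢a , yb≢0 , refl , refl)) = backward e e≢a yb≢0
      to : Residual yf yb a u v → ∃ (λ e → Forward e ⊎ Backward e)
      to (forward e e≢a yf≢0)  = e , inj₁ (e≢a , yf≢0 , refl , refl)
      to (backward e e≢a yb≢0) = e , inj₂ (e≢a , yb≢0 , refl , refl)

    path⇒reach : ∀ {u v} → Star (Residual yf yb a) u v → ReachWithout S a u v
    path⇒reach ε                      = here
    path⇒reach (forward e e≢a _ ◅ p)  = stepF e e≢a (path⇒reach p)
    path⇒reach (backward e e≢a _ ◅ p) = stepB e e≢a (path⇒reach p)

    reach-snoc˘ : ∀ {w u v} → ReachWithout S a w v → Residual yf yb a u v → ReachWithout S a w u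
    reach-snoc˘ here            (forward e e≢a _)  = stepB e e≢a here
    reach-snoc˘ here            (backward e e≢a _) = stepF e e≢a here
    reach-snoc˘ (stepF e e≢a r) arc                = stepF e e≢a (reach-snoc˘ r arc)
    reach-snoc˘ (stepB e e≢a r) arc                = stepB e e≢a (reach-snoc˘ r arc)

    path⇒reach˘ : ∀ {u v} → Star (Residual yf yb a) u v → ReachWithout S a v u
    path⇒reach˘ ε         = here
    path⇒reach˘ (arc ◅ p) = reach-snoc˘ (path⇒reach˘ p) arc

    path-flow : ∀ {u v} → Star (Residual yf yb a) u v → Flow yf yb u v
    path-flow ε                       = empty-flow
    path-flow (forward e _ yf≢0 ◅ p)  = forward-flow e yf≢0 ⊕ path-flow p
    path-flow (backward e _ yb≢0 ◅ p) = backward-flow e yb≢0 ⊕ path-flow p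

    path-flow-avoids : ∀ {u v} (p : Star (Residual yf yb a) u v)
                     → Flow.ff (path-flow p) a ≡ 0ℚ × Flow.fb (path-flow p) a ≡ 0ℚ
    path-flow-avoids ε = refl , refl
    path-flow-avoids (forward e e≢a _ ◅ p) =
      cong₂ _+_ (δ-≢ (e≢a ∘ sym)) (proj₁ (path-flow-avoids p)) , cong (0ℚ +_) (proj₂ (path-flow-avoids p))
    path-flow-avoids (backward e e≢a _ ◅ p) =
      cong (0ℚ +_) (proj₁ (path-flow-avoids p)) , cong₂ _+_ (δ-≢ (e≢a ∘ sym)) (proj₂ (path-flow-avoids p))

  -- The path and the forward arc of a form a cycle; pushing c = 1 + yb a units around it raises
  -- yf a - yb a by c, to 1 + yf a.
  push-cycle : ∀ {yf yb} → InP S yf yb → ∀ a → yf a ≢ 0ℚ → Star (Residual yf yb a) (hd S a) (tl S a)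
             → Refinement yf yb (λ yf′ yb′ → 1ℚ ≤ yf′ a - yb′ a)
  push-cycle {yf} {yb} y∈P@(_ , _ , _ , _ , nonnegf , nonnegb) a yfa≢0 path =
    _ , _ , proj₁ pushed , proj₂ pushed , gap
    where
    open Flow (path-flow path) using (ff; fb)
    c : ℚ
    c = 1ℚ + yb a
    pushed = add-circulation y∈P (forward-flow a yfa≢0 ⊕ path-flow path) (ℚ.+-mono-≤ 0≤1 (nonnegb a))
    shift : ∀ p q → 1ℚ + p ≡ (p + (1ℚ + q) * 1ℚ) - (q + (1ℚ + q) * 0ℚ)
    shift = solve 2 (λ p q → con 1ℚ :+ p
                          := (p :+ (con 1ℚ :+ q) :* con 1ℚ) :- (q :+ (con 1ℚ :+ q) :* con 0ℚ)) refl
    gap : 1ℚ ≤ (yf a + c * (δ a a + ff a)) - (yb a + c * (0ℚ + fb a))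
    gap = begin
      1ℚ
        ≤⟨ p≤p+q 1ℚ (nonnegf a) ⟩
      1ℚ + yf a
        ≡⟨ shift (yf a) (yb a) ⟩
      (yf a + c * 1ℚ) - (yb a + c * 0ℚ)
        ≡⟨ cong₂ (λ x y → (yf a + c * (x + y)) - (yb a + c * 0ℚ))
                 (sym (δ-refl a)) (sym (proj₁ (path-flow-avoids path))) ⟩
      (yf a + c * (δ a a + ff a)) - (yb a + c * 0ℚ)
        ≡⟨ cong (λ y → (yf a + c * (δ a a + ff a)) - (yb a + c * (0ℚ + y)))
                (sym (proj₂ (path-flow-avoids path))) ⟩
      (yf a + c * (δ a a + ff a)) - (yb a + c * (0ℚ + fb a))
        ∎
      where open ℚ.≤-Reasoning

  module _ {ℓ : Level} {C : Pred (Fin n) ℓ} (C? : Unary.Decidable C) where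

    χ : Fin n → ℚ
    χ v = if does (C? v) then 1ℚ else 0ℚ

    χ-∈ : ∀ {v} → C v → χ v ≡ 1ℚ
    χ-∈ {v} v∈C rewrite dec-true (C? v) v∈C = refl

    χ-∉ : ∀ {v} → ¬ C v → χ v ≡ 0ℚ
    χ-∉ {v} v∉C rewrite dec-false (C? v) v∉C = refl

    Crossing : Fin k → Set ℓ
    Crossing e = (C (hd S e) × ¬ C (tl S e)) ⊎ (¬ C (hd S e) × C (tl S e))

    crossing-edge : ∀ {a u w} → C u → ¬ C w → ReachWithout S a u w → ∃[ e ] (e ≢ a × Crossing e)
    crossing-edge u∈C w∉C here = ⊥-elim (w∉C u∈C)
    crossing-edge u∈C w∉C (stepF e e≢a r) with C? (hd S e)
    ... | yes hd∈C = crossing-edge hd∈C w∉C r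
    ... | no  hd∉C = e , e≢a , inj₂ (hd∉C , u∈C)
    crossing-edge u∈C w∉C (stepB e e≢a r) with C? (tl S e)
    ... | yes tl∈C = crossing-edge tl∈C w∉C r
    ... | no  tl∉C = e , e≢a , inj₁ (u∈C , tl∉C)

    module _ {yf yb} (y∈P : InP S yf yb) (a : Fin k)
             (closed : ∀ {u v} → Residual yf yb a u v → C v → C u) where

      flux-crossing : ∀ {e} → e ≢ a → Crossing e → flux χ (net yf yb) e ≤ - 1ℚ
      flux-crossing {e} e≢a (inj₁ (hd∈C , tl∉C)) = begin
        flux χ (net yf yb) e       ≡⟨ cong₂ (λ x y → (x - y) * (yf e - yb e)) (χ-∈ hd∈C) (χ-∉ tl∉C) ⟩
        (1ℚ - 0ℚ) * (yf e - yb e)  ≡⟨ cong (λ x → 1ℚ * (x - yb e)) yf≡0 ⟩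
        1ℚ * (0ℚ - yb e)           ≡⟨ trans (ℚ.*-identityˡ (0ℚ - yb e)) (ℚ.+-identityˡ (- yb e)) ⟩
        - yb e                     ≤⟨ ℚ.neg-antimono-≤ 1≤yb ⟩
        - 1ℚ                       ∎
        where
        open ℚ.≤-Reasoning
        yf≡0 : yf e ≡ 0ℚ
        yf≡0 = decidable-stable (yf e ℚ.≟ 0ℚ) λ yf≢0 → tl∉C (closed (forward e e≢a yf≢0) hd∈C)
        1≤yb : 1ℚ ≤ yb e
        1≤yb = subst (1ℚ ≤_) (trans (cong (_+ yb e) yf≡0) (ℚ.+-identityˡ (yb e))) (InP⇒covered y∈P e)
      flux-crossing {e} e≢a (inj₂ (hd∉C , tl∈C)) = begin
        flux χ (net yf yb) e       ≡⟨ cong₂ (λ x y → (x - y) * (yf e - yb e)) (χ-∉ hd∉C) (χ-∈ tl∈C) ⟩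
        (0ℚ - 1ℚ) * (yf e - yb e)  ≡⟨ -1*[p-q]≡q-p (yf e) (yb e) ⟩
        yb e - yf e                ≡⟨ cong (_- yf e) yb≡0 ⟩
        0ℚ - yf e                  ≡⟨ ℚ.+-identityˡ (- yf e) ⟩
        - yf e                     ≤⟨ ℚ.neg-antimono-≤ 1≤yf ⟩
        - 1ℚ                       ∎
        where
        open ℚ.≤-Reasoning
        yb≡0 : yb e ≡ 0ℚ
        yb≡0 = decidable-stable (yb e ℚ.≟ 0ℚ) λ yb≢0 → hd∉C (closed (backward e e≢a yb≢0) tl∈C)
        1≤yf : 1ℚ ≤ yf e
        1≤yf = subst (1ℚ ≤_) (trans (cong (yf e +_) yb≡0) (ℚ.+-identityʳ (yf e))) (InP⇒covered y∈P e)

      flux-uncrossed : ∀ {e} → χ (hd S e) ≡ χ (tl S e) → flux χ (net yf yb) e ≡ 0ℚ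
      flux-uncrossed {e} eq = begin
        (χ (hd S e) - χ (tl S e)) * net yf yb e  ≡⟨ cong (λ x → (x - χ (tl S e)) * net yf yb e) eq ⟩
        (χ (tl S e) - χ (tl S e)) * net yf yb e  ≡⟨ cong (_* net yf yb e) (ℚ.+-inverseʳ (χ (tl S e))) ⟩
        0ℚ * net yf yb e                         ≡⟨ ℚ.*-zeroˡ (net yf yb e) ⟩
        0ℚ                                       ∎
        where open ≡-Reasoning

      flux-nonpos : ∀ {e} → e ≢ a → flux χ (net yf yb) e ≤ 0ℚ
      flux-nonpos {e} e≢a = by-cases (C? (hd S e)) (C? (tl S e))
        where
        by-cases : Dec (C (hd S e)) → Dec (C (tl S e)) → flux χ (net yf yb) e ≤ 0ℚ
        by-cases (yes hd∈C) (yes tl∈C) = ℚ.≤-reflexive (flux-uncrossed (trans (χ-∈ hd∈C) (sym (χ-∈ tl∈C))))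
        by-cases (yes hd∈C) (no  tl∉C) = ℚ.≤-trans (flux-crossing e≢a (inj₁ (hd∈C , tl∉C))) -1≤0
        by-cases (no  hd∉C) (yes tl∈C) = ℚ.≤-trans (flux-crossing e≢a (inj₂ (hd∉C , tl∈C))) -1≤0
        by-cases (no  hd∉C) (no  tl∉C) = ℚ.≤-reflexive (flux-uncrossed (trans (χ-∉ hd∉C) (sym (χ-∉ tl∉C))))

      cut-nonneg : 0ℚ ≤ flux χ (net yf yb) a
      cut-nonneg = begin
        0ℚ                        ≡⟨ circulation-flux χ (InP⇒circulation y∈P) ⟨
        sum (flux χ (net yf yb))  ≤⟨ sum≤at (flux χ (net yf yb)) a (λ _ → flux-nonpos) ⟩
        flux χ (net yf yb) a      ∎
        where open ℚ.≤-Reasoning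

      cut-gap : ∀ {e} → e ≢ a → Crossing e → 1ℚ ≤ flux χ (net yf yb) a
      cut-gap {e} e≢a crossing = 0≤p-q⇒q≤p (begin
        0ℚ
          ≡⟨ circulation-flux χ (InP⇒circulation y∈P) ⟨
        sum (flux χ (net yf yb))
          ≤⟨ sum≤at₂ (flux χ (net yf yb)) a e e≢a (λ _ → flux-nonpos) ⟩
        flux χ (net yf yb) a + flux χ (net yf yb) e
          ≤⟨ ℚ.+-monoʳ-≤ (flux χ (net yf yb) a) (flux-crossing e≢a crossing) ⟩
        flux χ (net yf yb) a - 1ℚ
          ∎)
        where open ℚ.≤-Reasoning

  module _ {yf yb} (y∈P : InP S yf yb) (a : Fin k) where

    private
      reaches? : ∀ t → Unary.Decidable (λ v → Star (Residual yf yb a) v t)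
      reaches? t v = FiniteReachability.star? residual? v t

      flux-return : ¬ Star (Residual yf yb a) (hd S a) (tl S a)
                  → flux (χ (reaches? (tl S a))) (net yf yb) a ≡ yb a - yf a
      flux-return no-return =
        trans (cong₂ (λ x y → (x - y) * net yf yb a)
                     (χ-∉ (reaches? (tl S a)) no-return) (χ-∈ (reaches? (tl S a)) ε))
              (-1*[p-q]≡q-p (yf a) (yb a))

    no-return-bound : ¬ Star (Residual yf yb a) (hd S a) (tl S a) → 0ℚ ≤ yb a - yf a
    no-return-bound no-return =
      subst (0ℚ ≤_) (flux-return no-return) (cut-nonneg (reaches? (tl S a)) y∈P a _◅_)

    no-return-gap : ¬ Star (Residual yf yb a) (hd S a) (tl S a) → ReachWithout S a (tl S a) (hd S a)
                  → 1ℚ ≤ yb a - yf a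
    no-return-gap no-return r with crossing-edge (reaches? (tl S a)) ε no-return r
    ... | e , e≢a , crossing =
      subst (1ℚ ≤_) (flux-return no-return) (cut-gap (reaches? (tl S a)) y∈P a _◅_ e≢a crossing)

    no-passage-bound : ¬ Star (Residual yf yb a) (tl S a) (hd S a) → 0ℚ ≤ yf a - yb a
    no-passage-bound no-passage =
      subst (0ℚ ≤_) flux-passage (cut-nonneg (reaches? (hd S a)) y∈P a _◅_)
      where
      flux-passage : flux (χ (reaches? (hd S a))) (net yf yb) a ≡ yf a - yb a
      flux-passage =
        trans (cong₂ (λ x y → (x - y) * net yf yb a)
                     (χ-∈ (reaches? (hd S a)) ε) (χ-∉ (reaches? (hd S a)) no-passage))
              (ℚ.*-identityˡ (net yf yb a))

    bridge-balanced : Bridge S a → yf a ≡ yb a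
    bridge-balanced bridge = ℚ.≤-antisym (0≤p-q⇒q≤p (no-return-bound (bridge ∘ path⇒reach˘)))
                                         (0≤p-q⇒q≤p (no-passage-bound (bridge ∘ path⇒reach)))

  Settled : (Fin k → ℚ) → (Fin k → ℚ) → Fin k → Set
  Settled yf yb a = ¬ Bridge S a → yf a ≡ 0ℚ ⊎ yb a ≡ 0ℚ

  Settled-mono : ∀ {zf zb yf yb a} → SuppSub zf zb yf yb → Settled yf yb a → Settled zf zb a
  Settled-mono (zf⊆yf , zb⊆yb) settled = Sum.map (zf⊆yf _) (zb⊆yb _) ∘ settled

  settle : ∀ {yf yb} → InP S yf yb → ∀ a → Refinement yf yb (λ yf′ yb′ → Settled yf′ yb′ a)
  settle {yf} {yb} y∈P a with yf a ℚ.≟ 0ℚ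
  ... | yes yfa≡0 = unchanged y∈P (λ _ → inj₁ yfa≡0)
  ... | no  yfa≢0 with FiniteReachability.star? residual? (hd S a) (tl S a)
  ...   | yes return = refine-map (λ yb′a≡0 _ → inj₂ yb′a≡0)
                         (refine-bind (push-cycle y∈P a yfa≢0 return) (λ y′∈P → cancel-backward y′∈P a))
  ...   | no  no-return with 1ℚ ℚ.≤? yb a - yf a
  ...     | yes gap    = refine-map (λ yf′a≡0 _ → inj₁ yf′a≡0) (cancel-forward y∈P a gap)
  ...     | no  no-gap = unchanged y∈P λ not-bridge →
                           ⊥-elim (not-bridge (no-gap ∘ no-return-gap y∈P a no-return))

  settle-all : ∀ {xf xb} → InP S xf xb → (es : List (Fin k))
             → Refinement xf xb (λ yf yb → All (Settled yf yb) es)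
  settle-all x∈P []       = unchanged x∈P []
  settle-all x∈P (a ∷ es) = refine-bind (settle-all x∈P es) settle-next
    where
    settle-next : ∀ {yf yb} → InP S yf yb → All (Settled yf yb) es
                → Refinement yf yb (λ zf zb → All (Settled zf zb) (a ∷ es))
    settle-next y∈P settled with settle y∈P a
    ... | zf , zb , z∈P , z⊆y , settled-a =
      zf , zb , z∈P , z⊆y , settled-a ∷ All.map (Settled-mono z⊆y) settled

  Normalised : (Fin k → ℚ) → (Fin k → ℚ) → Set
  Normalised yf yb = ∀ a → (Bridge S a → (yf a ≡ ½ × yb a ≡ ½)) × (¬ Bridge S a → yf a ⊓ yb a ≡ 0ℚ)

  -- Once every non-bridge is settled, the edges with yf = yb are exactly the bridges.
  halve-bridges : ∀ {yf yb} → InP S yf yb → (∀ a → Settled yf yb a) → Refinement yf yb Normalised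
  halve-bridges {yf} {yb} y∈P@(_ , covered , _ , _ , nonnegf , nonnegb) settled =
    _ , _ , proj₁ refined , proj₂ refined , λ a → normalised a (yf a ℚ.≟ yb a)
    where
    pick : ∀ {p q : ℚ} → Dec (p ≡ q) → ℚ → ℚ
    pick (yes _) _ = ½
    pick (no _)  p = p
    refines : ∀ e (d : Dec (yf e ≡ yb e)) → Refines (yf e) (yb e) (pick d (yf e)) (pick d (yb e))
    refines e (yes yf≡yb) = subst (λ q → Refines (yf e) q ½ ½) yf≡yb
                                  (halve (subst (λ q → 1ℚ ≤ yf e + q) (sym yf≡yb) (covered e)))
    refines e (no _)      = Refines-refl y∈P e
    refined = refine y∈P λ e → refines e (yf e ℚ.≟ yb e)
    normalised : ∀ a (d : Dec (yf a ≡ yb a))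
             → (Bridge S a → (pick d (yf a) ≡ ½ × pick d (yb a) ≡ ½))
             × (¬ Bridge S a → pick d (yf a) ⊓ pick d (yb a) ≡ 0ℚ)
    normalised a (yes yf≡yb) = (λ _ → refl , refl) , λ not-bridge →
      ⊥-elim (1≰0 (subst (1ℚ ≤_) (vanishes (settled a not-bridge)) (covered a)))
      where
      vanishes : yf a ≡ 0ℚ ⊎ yb a ≡ 0ℚ → yf a + yb a ≡ 0ℚ
      vanishes (inj₁ yf≡0) = cong₂ _+_ yf≡0 (trans (sym yf≡yb) yf≡0)
      vanishes (inj₂ yb≡0) = cong₂ _+_ (trans yf≡yb yb≡0) yb≡0
    normalised a (no yf≢yb) =
      (λ bridge → ⊥-elim (yf≢yb (bridge-balanced y∈P a bridge))) , min-vanishes ∘ settled a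
      where
      min-vanishes : yf a ≡ 0ℚ ⊎ yb a ≡ 0ℚ → yf a ⊓ yb a ≡ 0ℚ
      min-vanishes (inj₁ yf≡0) = trans (cong (_⊓ yb a) yf≡0) (ℚ.p≤q⇒p⊓q≡p (nonnegb a))
      min-vanishes (inj₂ yb≡0) = trans (cong (yf a ⊓_) yb≡0) (ℚ.p≥q⇒p⊓q≡q (nonnegf a))

open import Data.List using (allFin)
open import Data.List.Membership.Propositional.Properties using (∈-allFin)
open import Data.List.Relation.Unary.All using (lookup)
open import Data.Nat using (_≤_)
open import Data.Rational using (ℚ; 0ℚ; ½; _⊓_)

lemma4p1 : (n k : ℕ) → 1 ≤ k → (S : Setup n k) → (xf xb : Fin k → ℚ) → InP S xf xb →
    Σ[ yf ∈ (Fin k → ℚ) ] Σ[ yb ∈ (Fin k → ℚ) ]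
      (InP S yf yb × SuppSub yf yb xf xb
       × (∀ a → (Bridge S a → (yf a ≡ ½ × yb a ≡ ½))
              × (¬ Bridge S a → yf a ⊓ yb a ≡ 0ℚ)))
-- The argument does not need B ≠ ∅.
lemma4p1 n k _ S xf xb x∈P =
  refine-bind (settle-all x∈P (allFin k)) λ y∈P settled → halve-bridges y∈P (lookup settled ∘ ∈-allFin)
  where open FlowPolyhedron S
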